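{- Let $A=(S_A,E_A,\delta_A,I_A)$ and $C=(S_C,E_C,\delta_C,I_C)$ be the state spaces of two Event-B machines with $S_A$ and $S_C$ finite, related by an Event-B refinement with new-event set $\mathcal{N}_C$ and renaming $\psi_{C,A}$, and suppose $A\sqsubseteq_{fd} C$. Suppose moreover that $A$ is event deterministic. Then $traces(A)\subseteq \tau_{C,A}(traces(C))$ and $traces(A)_\Delta \subseteq \tau_{C,A}(traces(C)_\Delta)$; that is, every finite and every infinite trace of $A$ has a concrete counterpart in $C$.
   Context: The state space of an Event-B machine $M$ is a quadruple $(S,E,\delta,I)$: $S$ is the set of states, $I\subseteq S$ the initial states, $E$ the set of events, and $\delta:E\to\mathcal{P}(S\times S)$ gives the transitions; write $s\xrightarrow{e}s'$ if $(s,s')\in\delta(e)$. The abstract machine is assumed to have a single initial state, $|I_A|=1$. In an Event-B refinement of $A$ by $C$, $\mathcal{N}_C\subseteq E_C$ is the set of new events of $C$ (those refining the invisible event skip), and $\psi_{C,A}:E_C\setminus\mathcal{N}_C\to E_A$ is a total surjective function assigning to each remaining concrete event the abstract event it refines (witness predicates are assumed deterministic so that this is a function). For a set $X$ of events, $\psi_{C,A}[X]=\{\psi_{C,A}(e)\mid e\in X\setminus\mathcal{N}_C\}$ and $\psi_{C,A}^{ -1}[\{y\}]=\{e\in E_C\setminus\mathcal{N}_C\mid \psi_{C,A}(e)=y\}$. Finite traces: a finite sequence $e_1,\dots,e_n$ is in $traces(M)$ if there exist $s_0\in I$ and states $s_1,\dots,s_n$ with $s_{i-1}\xrightarrow{e_i}s_i$;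 $last(\sigma)$ is the state $s_n$ reached by such a run. Infinite traces: $traces(M)_\Delta$ is the set of infinite sequences $e_0,e_1,\dots$ for which there exist $s_0\in I$ and states $s_1,s_2,\dots$ with $s_i\xrightarrow{e_i}s_{i+1}$ for all $i$. The operator $\tau_{C,A}$ on a (finite or infinite) sequence of concrete events deletes every event in $\mathcal{N}_C$ and replaces every other event $e$ by $\psi_{C,A}(e)$, preserving order (for finite traces: $\tau(\langle\rangle)=\langle\rangle$, $\tau(e_1,\dots,e_n)=\tau(e_2,\dots,e_n)$ if $e_1\in\mathcal{N}_C$, else $\psi_{C,A}(e_1)\frown\tau(e_2,\dots,e_n)$); it is applied elementwise to sets. For a state $s$ of $M$: $enabled(s)=\{e\mid \exists s'.\ (s,s')\in\delta(e)\}$ and $refusal(s)=E\setminus enabled(s)$. A state $s\in S_C$ is stable ($s\in stable_C$) if there is no $e\in\mathcal{N}_C$ and $s'$ with $s\xrightarrow{e}s'$ (for a machine with no new events, e.g. $A$, all states are stable). The failure traces of $M$ are $failure(M)=\{(\sigma,X)\mid \sigma\in traces(M),\ last(\sigma)\in stable_M,\ X=refusal(last(\sigma))\}$. For a refusal set $X$ of $C$, $AbsRefusal(X)=\{y\in\psi_{C,A}[X]\mid \psi_{C,A}^{ -1}[\{y\}]\subseteq X\}$. Failure trace refinement $A\sqsubseteq_f C$ means: for all $(\sigma,X)\in failure(C)$, $(\tau_{C,A}(\sigma),AbsRefusal(X))\in failure(A)$. The divergent states of $C$ are $divergence_C=\{s\mid$ there is a nonempty finite sequence $e_1,\dots,e_n$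 of events of $\mathcal{N}_C$ and a chain $s\xrightarrow{e_1}\cdots\xrightarrow{e_n}s\}$. Failure divergence refinement $A\sqsubseteq_{fd}C$ means $A\sqsubseteq_f C$ and $divergence_C=\emptyset$ (in the context of an Event-B refinement with $\tau_{C,A}(traces(C))\subseteq traces(A)$). A machine $M$ is event deterministic if for all $\sigma,X_1,X_2$: $\{(\sigma,X_1),(\sigma,X_2)\}\subseteq failure(M)$ implies $X_1=X_2$. -}

module Defs where

open import Data.Nat using (ℕ; zero; suc; _<_)
open import Data.Fin using (Fin)
open import Data.Bool using (Bool; true; false)
open import Data.Maybe using (Maybe; just; nothing)
open import Data.List using (List; []; _∷_)
open import Data.Product using (Σ; ∃; ∃-syntax; _×_; _,_)
open import Data.Sum using (_⊎_)
open import Data.Empty using (⊥)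
open import Data.List.Relation.Unary.All using (All)
open import Relation.Nullary using (¬_)
open import Relation.Binary.PropositionalEquality using (_≡_)
open import Function.Bundles using (_⇔_)

-- State space (S, E, δ, I) with finite S = Fin nS and finite E = Fin nE.
-- δ e s s' ≡ true  means  s --e--> s'.  init s ≡ true  means  s ∈ I.

record Machine : Set where
  field
    nS    : ℕ
    nE    : ℕ
    δ     : Fin nE → Fin nS → Fin nS → Bool
    init  : Fin nS → Bool

open Machine public

EventSet : Machine → Set₁
EventSet M = Fin (nE M) → Set

_≐_ : {M : Machine} → EventSet M → EventSet M → Set
_≐_ {M} X Y = (e : Fin (nE M)) → X e ⇔ Y e

data Path (M : Machine) : Fin (nS M) → List (Fin (nE M)) → Fin (nS M) → Set where
  done : ∀ {s} → Path M s [] s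
  step : ∀ {s s' t e σ} → δ M e s s' ≡ true → Path M s' σ t → Path M s (e ∷ σ) t

Trace : (M : Machine) → List (Fin (nE M)) → Set
Trace M σ = Σ (Fin (nS M)) λ s₀ → Σ (Fin (nS M)) λ t → (init M s₀ ≡ true × Path M s₀ σ t)

InfTrace : (M : Machine) → (ℕ → Fin (nE M)) → Set
InfTrace M σ = Σ (ℕ → Fin (nS M)) λ s → (init M (s 0) ≡ true × (∀ i → δ M (σ i) (s i) (s (suc i)) ≡ true))

Enabled : (M : Machine) → Fin (nS M) → EventSet M
Enabled M s e = Σ (Fin (nS M)) λ s' → (δ M e s s' ≡ true)

Refusal : (M : Machine) → Fin (nS M) → EventSet M
Refusal M s e = ¬ Enabled M s e

Stable : (M : Machine) → (Fin (nE M) → Set) → Fin (nS M) → Set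
Stable M isNew s = ∀ e s' → isNew e → δ M e s s' ≡ true → ⊥

-- failure(M), for a machine whose new events are given by isNew;
-- last(σ) is the end state of some run of σ from an initial state.
Failure : (M : Machine) → (Fin (nE M) → Set) → List (Fin (nE M)) → EventSet M → Set
Failure M isNew σ X =
  Σ (Fin (nS M)) λ s₀ → Σ (Fin (nS M)) λ t → (init M s₀ ≡ true × Path M s₀ σ t × Stable M isNew t × _≐_ {M} X (Refusal M t))

NoNew : (M : Machine) → Fin (nE M) → Set
NoNew M e = ⊥

EventDeterministic : Machine → Set₁
EventDeterministic M =
  ∀ σ (X₁ X₂ : EventSet M) → Failure M (NoNew M) σ X₁ → Failure M (NoNew M) σ X₂ → _≐_ {M} X₁ X₂

-- Refinement data: ψ : E_C → Maybe E_A.  ψ e ≡ nothing  iff  e ∈ N_C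
-- (a new event); otherwise ψ e ≡ just (ψ_{C,A}(e)).

module Refinement (A C : Machine) (ψ : Fin (nE C) → Maybe (Fin (nE A))) where

  New : Fin (nE C) → Set
  New e = ψ e ≡ nothing

  Surjective : Set
  Surjective = ∀ y → Σ (Fin (nE C)) λ e → (ψ e ≡ just y)

  τ : List (Fin (nE C)) → List (Fin (nE A))
  τ [] = []
  τ (e ∷ σ) with ψ e
  ... | nothing = τ σ
  ... | just y  = y ∷ τ σ

  -- τ_{C,A}(ρ) = σ for an infinite concrete ρ and an infinite abstract σ:
  -- f enumerates, in increasing order, exactly the positions of ρ that
  -- carry non-new events, and ψ maps them to σ.
  TauInf : (ℕ → Fin (nE C)) → (ℕ → Fin (nE A)) → Set
  TauInf ρ σ = Σ (ℕ → ℕ) λ f → ((∀ i → f i < f (suc i))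
                     × (∀ i → ψ (ρ (f i)) ≡ just (σ i))
                     × (∀ j → ψ (ρ j) ≡ nothing ⊎ Σ ℕ (λ i → f i ≡ j)))

  AbsRefusal : EventSet C → EventSet A
  AbsRefusal X y = (Σ (Fin (nE C)) λ e → (X e × ψ e ≡ just y)) × (∀ e → ψ e ≡ just y → X e)

  Divergent : Fin (nS C) → Set
  Divergent s = Σ (Fin (nE C)) λ e → Σ (List (Fin (nE C))) λ es →
    (New e × All New es × Path C s (e ∷ es) s)

  TraceRefines : Set
  TraceRefines = ∀ ρ → Trace C ρ → Trace A (τ ρ)

  FailureRefines : Set₁
  FailureRefines = ∀ σ (X : EventSet C) → Failure C New σ X → Failure A (NoNew A) (τ σ) (AbsRefusal X)

  FDRefines : Set₁
  FDRefines = FailureRefines × (∀ s → ¬ Divergent s)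

{-# OPTIONS --safe #-}
module Submission where

-- Let a concrete run ρ end in t while the abstract trace τ ρ extends by y. As C is finite and
-- divergence free, new events lead from t to a stable state w. Failure refinement puts
-- (τ ρ, AbsRefusal (refusal w)) into failure(A), and event determinism identifies this refusal
-- with that of the abstract state reached along τ ρ, which does not refuse y. Hence an event
-- refining y is enabled at w, and ρ extends by a block of new events followed by that event.
-- Finite traces are lifted block by block, infinite ones by concatenating infinitely many blocks.

open import Defs
open import Data.Nat using (ℕ; zero; suc; _+_; _≤_; _<_; _≤′_; ≤′-refl; ≤′-step; s≤s)
open import Data.Nat.Properties using (+-suc; +-identityʳ; <⇒≤; ≤⇒≤′; m≤m+n; n<1+n; suc-injective)
open import Data.Fin using (Fin; toℕ)
open import Data.Fin.Properties using (any?; pigeonhole; toℕ<n) renaming (_≟_ to _≟ᶠ_)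
open import Data.Maybe using (Maybe; just; nothing)
open import Data.Maybe.Properties using (≡-dec)
open import Data.Bool using (true)
open import Data.Bool.Properties using () renaming (_≟_ to _≟ᵇ_)
open import Data.List using (List; []; _∷_; _++_; [_]; length)
open import Data.List.Properties using (++-identityʳ)
open import Data.List.Relation.Unary.All using (All; []; _∷_)
open import Data.List.Relation.Unary.All.Properties using (++⁺)
open import Data.Product using (Σ; _×_; _,_; proj₁; proj₂)
open import Data.Sum using (_⊎_; inj₁; inj₂)
open import Data.Empty using (⊥-elim)
open import Relation.Nullary using (¬_; yes; no)
open import Relation.Nullary.Decidable using (_×-dec_)
open import Relation.Unary using (Decidable)
open import Relation.Binary.PropositionalEquality using (_≡_; refl; sym; trans; cong; cong₂; subst; subst₂; module ≡-Reasoning)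
open import Function.Bundles using (_⇔_; Equivalence)
open import Function.Construct.Identity using (⇔-id)

_++ᵖ_ : ∀ {M s σ t σ' u} → Path M s σ t → Path M t σ' u → Path M s (σ ++ σ') u
done     ++ᵖ q = q
step d p ++ᵖ q = step d (p ++ᵖ q)

failure-at : ∀ {M isNew s₀ σ t} → init M s₀ ≡ true → Path M s₀ σ t → Stable M isNew t
           → Failure M isNew σ (Refusal M t)
failure-at s₀-init p t-stable = _ , _ , s₀-init , p , t-stable , λ _ → ⇔-id _

module Stabilisation (M : Machine) {isNew : Fin (nE M) → Set} (isNew? : Decidable isNew) where

  NewStep : Fin (nS M) → Fin (nS M) → Set
  NewStep s t = Σ (Fin (nE M)) λ e → isNew e × δ M e s t ≡ true

  NewPath : Fin (nS M) → Fin (nS M) → Set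
  NewPath s t = Σ (List (Fin (nE M))) λ es → All isNew es × Path M s es t

  NewCycle : Fin (nS M) → Set
  NewCycle s = Σ (Fin (nE M)) λ e → Σ (List (Fin (nE M))) λ es → isNew e × All isNew es × Path M s (e ∷ es) s

  Stabilises : Fin (nS M) → Set
  Stabilises s = Σ (Fin (nS M)) λ t → Stable M isNew t × NewPath s t

  NewRun : ℕ → Fin (nS M) → Set
  NewRun n s = Σ (ℕ → Fin (nS M)) λ w → w 0 ≡ s × (∀ i → i < n → NewStep (w i) (w (suc i)))

  stable-or-step : ∀ s → Stable M isNew s ⊎ Σ (Fin (nS M)) (NewStep s)
  stable-or-step s with any? (λ e → any? (λ t → isNew? e ×-dec (δ M e s t ≟ᵇ true)))
  ... | yes (e , t , new , d) = inj₂ (t , e , new , d)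
  ... | no ¬step             = inj₁ λ e t new d → ¬step (e , t , new , d)

  stabilises-or-run : ∀ n s → Stabilises s ⊎ NewRun n s
  stabilises-or-run zero s = inj₂ ((λ _ → s) , refl , λ _ ())
  stabilises-or-run (suc n) s with stable-or-step s
  ... | inj₁ s-stable = inj₁ (s , s-stable , [] , [] , done)
  ... | inj₂ (t , e , new , d) with stabilises-or-run n t
  ...   | inj₁ (u , u-stable , es , news , p) = inj₁ (u , u-stable , e ∷ es , new ∷ news , step d p)
  ...   | inj₂ (w , refl , steps) = inj₂ (w′ , refl , steps′)
    where
      w′ : ℕ → Fin (nS M)
      w′ zero    = s
      w′ (suc i) = w i
      steps′ : ∀ i → i < suc n → NewStep (w′ i) (w′ (suc i))
      steps′ zero    _         = e , new , d
      steps′ (suc i) (s≤s i<n) = steps i i<n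

  run-segment : ∀ {n s} ((w , _ , _) : NewRun n s) {i j} → i ≤′ j → j ≤ n → NewPath (w i) (w j)
  run-segment _                ≤′-refl        _   = [] , [] , done
  run-segment r@(_ , _ , steps) (≤′-step i≤j) j<n with run-segment r i≤j (<⇒≤ j<n) | steps _ j<n
  ... | es , news , p | e , new , d = es ++ [ e ] , ++⁺ news (new ∷ []) , p ++ᵖ step d done

  long-run-cycle : ∀ {s} → NewRun (suc (nS M)) s → Σ (Fin (nS M)) NewCycle
  long-run-cycle r@(w , _ , steps) with pigeonhole (n<1+n (nS M)) (λ i → w (toℕ i))
  ... | i , j , i<j , wi≡wj with steps (toℕ i) (toℕ<n i) | run-segment r (≤⇒≤′ i<j) (<⇒≤ (toℕ<n j))
  ...   | e , new , d | es , news , p =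
    w (toℕ i) , e , es , new , news , step d (subst (Path M _ es) (sym wi≡wj) p)

  stabilise : (∀ s → ¬ NewCycle s) → ∀ s → Stabilises s
  stabilise acyclic s with stabilises-or-run (suc (nS M)) s
  ... | inj₁ stabilises = stabilises
  ... | inj₂ run with long-run-cycle run
  ...   | t , cycle = ⊥-elim (acyclic t cycle)

record Block (M : Machine) (isNew : Fin (nE M) → Set) (s t : Fin (nS M)) : Set where
  field
    silent      : List (Fin (nE M))
    mid         : Fin (nS M)
    silent-new  : All isNew silent
    silent-path : Path M s silent mid
    event       : Fin (nE M)
    event-step  : δ M event mid t ≡ true

  word : List (Fin (nE M))
  word = silent ++ [ event ]

  word-path : Path M s word t
  word-path = silent-path ++ᵖ step event-step done

module Concatenation (M : Machine) {isNew : Fin (nE M) → Set}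
                     (T : ℕ → Fin (nS M)) (b : ∀ i → Block M isNew (T i) (T (suc i))) where
  open Block

  -- The new events of block `index` still to be run from `state`; once they are used up,
  -- the current event is the block's final event.
  record Cursor : Set where
    constructor cursor
    field
      index        : ℕ
      state        : Fin (nS M)
      pending      : List (Fin (nE M))
      pending-new  : All isNew pending
      pending-path : Path M state pending (mid (b index))

    remaining : ℕ
    remaining = length pending
  open Cursor

  enter : ℕ → Cursor
  enter i = cursor i (T i) (silent (b i)) (silent-new (b i)) (silent-path (b i))

  current : Cursor → Fin (nE M)
  current (cursor _ _ (e ∷ _) _ _) = e
  current (cursor i _ []      _ _) = event (b i)

  advance : Cursor → Cursor
  advance (cursor i _ (_ ∷ es) (_ ∷ news) (step {s' = u} _ p)) = cursor i u es news p
  advance (cursor i _ []       []         done)                = enter (suc i)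

  current-step : ∀ c → δ M (current c) (state c) (state (advance c)) ≡ true
  current-step (cursor _ _ (_ ∷ _) (_ ∷ _) (step d _)) = d
  current-step (cursor i _ []      []      done)       = event-step (b i)

  data Advance (c : Cursor) : Set where
    within : isNew (current c) → index (advance c) ≡ index c → suc (remaining (advance c)) ≡ remaining c
           → Advance c
    at-end : remaining c ≡ 0 → current c ≡ event (b (index c)) → advance c ≡ enter (suc (index c))
           → Advance c

  classify : ∀ c → Advance c
  classify (cursor _ _ (_ ∷ _) (new ∷ _) (step _ _)) = within new refl refl
  classify (cursor _ _ []      []        done)       = at-end refl refl refl

  position : ℕ → Cursor
  position zero    = enter 0
  position (suc j) = advance (position j)

  events : ℕ → Fin (nE M)
  events j = current (position j)

  states : ℕ → Fin (nS M)
  states j = state (position j)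

  events-step : ∀ j → δ M (events j) (states j) (states (suc j)) ≡ true
  events-step j = current-step (position j)

  width : ℕ → ℕ
  width i = length (silent (b i))

  ends : ℕ → ℕ
  ends zero    = width 0
  ends (suc i) = suc (ends i + width (suc i))

  ends-increasing : ∀ i → ends i < ends (suc i)
  ends-increasing i = s≤s (m≤m+n (ends i) (width (suc i)))

  end-position : ∀ j → remaining (position j) ≡ 0 → j ≡ ends (index (position j))

  remaining-to-end : ∀ j → j + remaining (position j) ≡ ends (index (position j))
  remaining-to-end zero    = refl
  remaining-to-end (suc j) with classify (position j)
  ... | within _ same-index one-less = begin
    suc j + remaining (position (suc j))   ≡⟨ sym (+-suc j _) ⟩
    j + suc (remaining (position (suc j))) ≡⟨ cong (j +_) one-less ⟩
    j + remaining (position j)             ≡⟨ remaining-to-end j ⟩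
    ends (index (position j))              ≡⟨ cong ends (sym same-index) ⟩
    ends (index (position (suc j)))        ∎
    where open ≡-Reasoning
  ... | at-end none _ entered = begin
    suc j + remaining (position (suc j)) ≡⟨ cong (λ c → suc j + remaining c) entered ⟩
    suc (j + width (suc i))              ≡⟨ cong (λ k → suc (k + width (suc i))) (end-position j none) ⟩
    suc (ends i + width (suc i))         ≡⟨ cong (λ c → ends (index c)) (sym entered) ⟩
    ends (index (position (suc j)))      ∎
    where
      open ≡-Reasoning
      i = index (position j)

  end-position j none = trans (sym (+-identityʳ j)) (trans (cong (j +_) (sym none)) (remaining-to-end j))

  AtEnd : ℕ → ℕ → Set
  AtEnd i j = index (position j) ≡ i × remaining (position j) ≡ 0

  reaches-end : ∀ r j → remaining (position j) ≡ r → AtEnd (index (position j)) (j + r)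
  reaches-end zero    j none = subst (AtEnd _) (sym (+-identityʳ j)) (refl , none)
  reaches-end (suc r) j left with classify (position j)
  ... | within _ same-index one-less =
    subst₂ AtEnd same-index (sym (+-suc j r)) (reaches-end r (suc j) (suc-injective (trans one-less left)))
  ... | at-end none _ _ with () ← trans (sym none) left

  at-ends : ∀ i → AtEnd i (ends i)
  at-ends zero    = reaches-end (width 0) 0 refl
  at-ends (suc i) with at-ends i | classify (position (ends i))
  ... | _ , none | within _ _ one-less with () ← trans one-less none
  ... | same-index , _ | at-end _ _ entered =
    subst (λ k → AtEnd k (ends (suc i))) (cong index entered′)
          (reaches-end (width (suc i)) (suc (ends i)) (cong remaining entered′))
    where
      entered′ : position (suc (ends i)) ≡ enter (suc i)
      entered′ = trans entered (cong (λ k → enter (suc k)) same-index)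

  events-at-ends : ∀ i → events (ends i) ≡ event (b i)
  events-at-ends i with at-ends i | classify (position (ends i))
  ... | _ , none | within _ _ one-less with () ← trans one-less none
  ... | same-index , _ | at-end _ at-event _ = trans at-event (cong (λ k → event (b k)) same-index)

  events-new-or-end : ∀ j → isNew (events j) ⊎ Σ ℕ λ i → ends i ≡ j
  events-new-or-end j with classify (position j)
  ... | within new _ _ = inj₁ new
  ... | at-end none _ _ = inj₂ (index (position j) , sym (end-position j none))

module Simulation (A C : Machine) (ψ : Fin (nE C) → Maybe (Fin (nE A))) where
  open Refinement A C ψ
  open Block

  τ-++ : ∀ ρ ρ′ → τ (ρ ++ ρ′) ≡ τ ρ ++ τ ρ′
  τ-++ []      ρ′ = refl
  τ-++ (e ∷ ρ) ρ′ with ψ e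
  ... | nothing = τ-++ ρ ρ′
  ... | just y  = cong (y ∷_) (τ-++ ρ ρ′)

  τ-new : ∀ {es} → All New es → τ es ≡ []
  τ-new {[]}     []           = refl
  τ-new {e ∷ es} (new ∷ news) with ψ e | new
  ... | nothing | refl = τ-new news

  τ-refining : ∀ {e y} ρ → ψ e ≡ just y → τ (e ∷ ρ) ≡ y ∷ τ ρ
  τ-refining {e} ρ refines with ψ e | refines
  ... | just _ | refl = refl

  τ-++-new : ∀ ρ {es} → All New es → τ (ρ ++ es) ≡ τ ρ
  τ-++-new ρ {es} news = trans (τ-++ ρ es) (trans (cong (τ ρ ++_) (τ-new news)) (++-identityʳ (τ ρ)))

  New? : Decidable New
  New? e = ≡-dec _≟ᶠ_ (ψ e) nothing

  Enabled? : ∀ s → Decidable (Enabled C s)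
  Enabled? s e = any? (λ s′ → δ C e s s′ ≟ᵇ true)

  record Realisation (t : Fin (nS C)) (y : Fin (nE A)) : Set where
    field
      target  : Fin (nS C)
      block   : Block C New t target
      refines : ψ (event block) ≡ just y

    τ-word : τ (word block) ≡ [ y ]
    τ-word = trans (τ-++ (silent block) [ event block ])
                   (cong₂ _++_ (τ-new (silent-new block)) (τ-refining [] refines))

  open Realisation

  enabled-refining : Surjective → ∀ w y → ¬ AbsRefusal (Refusal C w) y
                   → Σ (Fin (nE C)) λ e → ψ e ≡ just y × Enabled C w e
  enabled-refining surj w y not-refused
    with any? (λ e → ≡-dec _≟ᶠ_ (ψ e) (just y) ×-dec Enabled? w e)
  ... | yes (e , refines , enabled) = e , refines , enabled
  ... | no ¬enabled with surj y
  ...   | e , e-refines = ⊥-elim (not-refused ((e , refused e e-refines , e-refines) , refused))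
    where
      refused : ∀ e → ψ e ≡ just y → Refusal C w e
      refused e refines enabled = ¬enabled (e , refines , enabled)

  record Corresponding (t : Fin (nS C)) (u : Fin (nS A)) : Set where
    constructor corresponding
    field
      run     : List (Fin (nE C))
      c-start : Fin (nS C)
      c-init  : init C c-start ≡ true
      c-path  : Path C c-start run t
      a-start : Fin (nS A)
      a-init  : init A a-start ≡ true
      a-path  : Path A a-start (τ run) u
  open Corresponding

  corresponding-init : ∀ {c a} → init C c ≡ true → init A a ≡ true → Corresponding c a
  corresponding-init c-init a-init = corresponding [] _ c-init done _ a-init done

  corresponding-step : ∀ {t u y u′} → Corresponding t u → (r : Realisation t y) → δ A y u u′ ≡ true
                     → Corresponding (target r) u′
  corresponding-step {y = y} c r d =
    corresponding (run c ++ word (block r)) _ (c-init c) (c-path c ++ᵖ word-path (block r)) _ (a-init c)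
      (subst (λ σ → Path A _ σ _) (sym τ-run) (a-path c ++ᵖ step d done))
    where
      τ-run : τ (run c ++ word (block r)) ≡ τ (run c) ++ [ y ]
      τ-run = trans (τ-++ (run c) (word (block r))) (cong (τ (run c) ++_) (τ-word r))

  module Lifting (surj : Surjective) (failure-refines : FailureRefines)
                 (no-divergence : ∀ s → ¬ Divergent s) (det : EventDeterministic A) where

    realise : ∀ {t u y u′} → Corresponding t u → δ A y u u′ ≡ true → Realisation t y
    realise {t} {u} {y} {u′} c d with Stabilisation.stabilise C New? no-divergence t
    ... | w , w-stable , es , news , p with enabled-refining surj w y y-not-refused
      where
        concrete : Failure A (NoNew A) (τ (run c)) (AbsRefusal (Refusal C w))
        concrete = subst (λ σ → Failure A (NoNew A) σ _) (τ-++-new (run c) news)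
                         (failure-refines _ _ (failure-at (c-init c) (c-path c ++ᵖ p) w-stable))
        abstract′ : Failure A (NoNew A) (τ (run c)) (Refusal A u)
        abstract′ = failure-at (a-init c) (a-path c) λ _ _ ()
        y-not-refused : ¬ AbsRefusal (Refusal C w) y
        y-not-refused refused = Equivalence.to (det _ _ _ concrete abstract′ y) refused (u′ , d)
    ...   | e , refines , t′ , e-step =
      record { target = t′ ; refines = refines
             ; block  = record { silent = es ; mid = w ; silent-new = news ; silent-path = p
                               ; event = e ; event-step = e-step } }

    lift : ∀ {t u σ v} → Corresponding t u → Path A u σ v
         → Σ (List (Fin (nE C))) λ ρ → Σ (Fin (nS C)) λ t′ → Path C t ρ t′ × τ ρ ≡ σ
    lift {t} c done = [] , t , done , refl
    lift c (step d q) with realise c d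
    ... | r with lift (corresponding-step c r d) q
    ...   | ρ , t′ , p , τρ≡σ =
      word (block r) ++ ρ , t′ , word-path (block r) ++ᵖ p ,
      trans (τ-++ (word (block r)) ρ) (cong₂ _++_ (τ-word r) τρ≡σ)

    lift-trace : ∀ {c₀} → init C c₀ ≡ true → ∀ σ → Trace A σ
               → Σ (List (Fin (nE C))) λ ρ → Trace C ρ × τ ρ ≡ σ
    lift-trace c₀-init σ (_ , _ , a₀-init , q) with lift (corresponding-init c₀-init a₀-init) q
    ... | ρ , t , p , τρ≡σ = ρ , (_ , t , c₀-init , p) , τρ≡σ

    lift-inf-trace : ∀ {c₀} → init C c₀ ≡ true → ∀ σ → InfTrace A σ
                   → Σ (ℕ → Fin (nE C)) λ ρ → InfTrace C ρ × TauInf ρ σ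
    lift-inf-trace {c₀} c₀-init σ (s , s₀-init , s-steps) =
      events , (states , c₀-init , events-step) , ends , ends-increasing , events-refine , events-new-or-end
      where
        reached : ∀ n → Σ (Fin (nS C)) λ t → Corresponding t (s n)
        realisation : ∀ n → Realisation (proj₁ (reached n)) (σ n)

        reached zero    = c₀ , corresponding-init c₀-init s₀-init
        reached (suc n) = target (realisation n) , corresponding-step (proj₂ (reached n)) (realisation n) (s-steps n)

        realisation n = realise (proj₂ (reached n)) (s-steps n)

        open Concatenation C (λ n → proj₁ (reached n)) (λ n → block (realisation n))

        events-refine : ∀ i → ψ (events (ends i)) ≡ just (σ i)
        events-refine i = trans (cong ψ (events-at-ends i)) (refines (realisation i))

proposition2 : (A C : Machine) (ψ : Fin (nE C) → Maybe (Fin (nE A)))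
    → Refinement.Surjective A C ψ
    → (Σ (Fin (nS A)) λ a₀ → (∀ s → (init A s ≡ true) ⇔ (s ≡ a₀)))
    → (Σ (Fin (nS C)) λ c₀ → (init C c₀ ≡ true))
    → Refinement.TraceRefines A C ψ
    → Refinement.FDRefines A C ψ
    → EventDeterministic A
    → ((σ : List (Fin (nE A))) → Trace A σ
          → Σ (List (Fin (nE C))) λ ρ → (Trace C ρ × Refinement.τ A C ψ ρ ≡ σ))
      × ((σ : ℕ → Fin (nE A)) → InfTrace A σ
          → Σ (ℕ → Fin (nE C)) λ ρ → (InfTrace C ρ × Refinement.TauInf A C ψ ρ σ))
proposition2 A C ψ surj _ (_ , c₀-init) _ (failure-refines , no-divergence) det =
  lift-trace c₀-init , lift-inf-trace c₀-init
  where open Simulation.Lifting A C ψ surj failure-refines no-divergence det
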